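{- Let $G$ be a finite simple graph and let $\delta\colon E_G\to\{\text{blue},\text{red}\}$ be a coloring of its edges such that $G$ has no almost red cycles and no almost blue cycles. If $H$ is a $\triangle$-connected subgraph of $G$, then $\delta(e)=\delta(e')$ for all $e,e'\in E_H$.
   Context: A cycle is almost red if exactly one of its edges is blue, and almost blue if exactly one of its edges is red. For a graph $H$, let $\sim'$ be the relation on $E_H$ with $e_1\sim' e_2$ iff there is a triangle (subgraph isomorphic to $C_3$) of $H$ containing both $e_1$ and $e_2$, and let $\sim$ be the reflexive-transitive closure of $\sim'$. The graph $H$ is $\triangle$-connected if $e_1\sim e_2$ for all $e_1,e_2\in E_H$ (in particular a single edge is $\triangle$-connected). -}

module Defs where

open import Data.Nat using (ℕ; zero; suc; _+_; _<?_)
open import Data.Fin using (Fin; zero; suc; toℕ; fromℕ<)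
open import Data.Bool using (Bool; true; false)
open import Data.Product using (Σ; _×_; _,_; ∃)
open import Data.Sum using (_⊎_)
open import Relation.Nullary using (¬_; yes; no)
open import Relation.Binary.PropositionalEquality using (_≡_)
open import Relation.Binary.Construct.Closure.ReflexiveTransitive using (Star)
open import Function.Definitions using (Injective)

data Colour : Set where
  blue red : Colour

record Graph (n : ℕ) : Set where
  field
    adj   : Fin n → Fin n → Bool
    sym   : ∀ u v → adj u v ≡ true → adj v u ≡ true
    irefl : ∀ u → ¬ (adj u u ≡ true)
open Graph public

-- An edge colouring δ : E_G → {blue, red}.  Given as a function on ordered
-- pairs whose value on an edge does not depend on the orientation;
-- values on non-edges are irrelevant.
record Colouring {n : ℕ} (G : Graph n) : Set where
  field
    col     : Fin n → Fin n → Colour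
    col-sym : ∀ u v → adj G u v ≡ true → col u v ≡ col v u
open Colouring public

count : ∀ {m} → (Fin m → Bool) → ℕ
count {zero}  p = 0
count {suc m} p with p zero
... | true  = suc (count (λ i → p (suc i)))
... | false = count (λ i → p (suc i))

next : ∀ {m} → Fin m → Fin m
next {suc k} i with suc (toℕ i) <? suc k
... | yes p = fromℕ< p
... | no  _ = zero

isColour : Colour → Colour → Bool
isColour blue blue = true
isColour red  red  = true
isColour _    _    = false

-- A cycle of G of length m ≥ 3: an injective sequence of vertices
-- c 0, …, c (m-1) with c i adjacent to c (i+1 mod m).
record Cycle {n : ℕ} (G : Graph n) : Set where
  field
    len    : ℕ
    vtx    : Fin (3 + len) → Fin n
    inj    : Injective _≡_ _≡_ vtx
    consec : ∀ i → adj G (vtx i) (vtx (next i)) ≡ true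
open Cycle public

colourCount : ∀ {n} {G : Graph n} → Colouring G → Cycle G → Colour → ℕ
colourCount δ C κ = count (λ i → isColour (col δ (vtx C i) (vtx C (next i))) κ)

AlmostRed : ∀ {n} {G : Graph n} → Colouring G → Cycle G → Set
AlmostRed δ C = colourCount δ C blue ≡ 1

AlmostBlue : ∀ {n} {G : Graph n} → Colouring G → Cycle G → Set
AlmostBlue δ C = colourCount δ C red ≡ 1

-- Vertices of H play no role
-- in the statement (only E_H and triangles of H matter).
record Subgraph {n : ℕ} (G : Graph n) : Set where
  field
    hadj : Fin n → Fin n → Bool
    hsym : ∀ u v → hadj u v ≡ true → hadj v u ≡ true
    hsub : ∀ u v → hadj u v ≡ true → adj G u v ≡ true
open Subgraph public

-- edges of H, represented by oriented pairs (u , v) with uv ∈ E_H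
EdgeOf : ∀ {n} {G : Graph n} → Subgraph G → Set
EdgeOf {n} H = Σ (Fin n × Fin n) (λ { (u , v) → hadj H u v ≡ true })

_∈₃_ : ∀ {n} → Fin n → Fin n × Fin n × Fin n → Set
x ∈₃ (a , b , c) = x ≡ a ⊎ x ≡ b ⊎ x ≡ c

SameEdge : ∀ {n} {G : Graph n} {H : Subgraph G} → EdgeOf H → EdgeOf H → Set
SameEdge ((a , b) , _) ((c , d) , _) = (a ≡ c × b ≡ d) ⊎ (a ≡ d × b ≡ c)

TriRel : ∀ {n} {G : Graph n} (H : Subgraph G) → EdgeOf H → EdgeOf H → Set
TriRel {n} H ((a , b) , _) ((c , d) , _) =
  ∃ λ (t : Fin n × Fin n × Fin n) →
    let (x , y , z) = t in
    (hadj H x y ≡ true × hadj H y z ≡ true × hadj H x z ≡ true) ×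
    (a ∈₃ t × b ∈₃ t) × (c ∈₃ t × d ∈₃ t)

-- e₁ ∼ e₂ : reflexive-transitive closure of ∼' on E_H (SameEdge accounts
-- for the two orientations representing one unordered edge)
Tri∼ : ∀ {n} {G : Graph n} (H : Subgraph G) → EdgeOf H → EdgeOf H → Set
Tri∼ H = Star (λ f g → TriRel H f g ⊎ SameEdge {H = H} f g)

TriConnected : ∀ {n} {G : Graph n} → Subgraph G → Set
TriConnected H = (e₁ e₂ : EdgeOf H) → Tri∼ H e₁ e₂

module Submission where

-- A triangle of G is a cycle of length 3; among three edge
-- colours, "not exactly one blue" and "not exactly one red" together force
-- all three colours to agree.  Hence, as G has no almost red and no almost
-- blue cycles, every triangle of G is monochromatic.  Two edges related by
-- ∼' lie in a common triangle of H ⊆ G and therefore have the same colour;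
-- two oriented representatives of one edge have the same colour because the
-- colouring is symmetric.  Colour is thus invariant along ∼, and
-- △-connectedness of H relates any two of its edges.

open import Defs
open import Data.Nat using (ℕ; suc; _+_)
open import Data.Nat.Properties using (+-identityʳ)
open import Data.Fin using (Fin; zero; suc)
open import Data.Bool using (Bool; true; false)
open import Data.Product using (proj₁; proj₂; _,_; _×_)
open import Data.Sum using (_⊎_; inj₁; inj₂)
open import Data.Empty using (⊥-elim)
open import Function using (_on_)
open import Level using (0ℓ)
open import Relation.Nullary using (¬_)
open import Relation.Binary using (Rel; _⇒_)
open import Relation.Binary.PropositionalEquality using (_≡_; refl; trans; cong; module ≡-Reasoning) renaming (sym to ≡-sym)
open import Relation.Binary.Construct.Closure.ReflexiveTransitive using (Star; gfold)

indicator : Bool → ℕ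
indicator true  = 1
indicator false = 0

count-suc : ∀ {m} (p : Fin (suc m) → Bool) → count p ≡ indicator (p zero) + count (λ i → p (suc i))
count-suc p with p zero
... | true  = refl
... | false = refl

count-three : (p : Fin 3 → Bool) →
  count p ≡ indicator (p zero) + (indicator (p (suc zero)) + indicator (p (suc (suc zero))))
count-three p = begin
  count p                                     ≡⟨ count-suc p ⟩
  b₀ + count (λ i → p (suc i))                ≡⟨ cong (b₀ +_) (count-suc (λ i → p (suc i))) ⟩
  b₀ + (b₁ + count (λ i → p (suc (suc i))))   ≡⟨ cong (λ k → b₀ + (b₁ + k)) (count-suc (λ i → p (suc (suc i)))) ⟩
  b₀ + (b₁ + (b₂ + 0))                        ≡⟨ cong (λ k → b₀ + (b₁ + k)) (+-identityʳ b₂) ⟩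
  b₀ + (b₁ + b₂)                              ∎
  where
  open ≡-Reasoning
  b₀ b₁ b₂ : ℕ
  b₀ = indicator (p zero)
  b₁ = indicator (p (suc zero))
  b₂ = indicator (p (suc (suc zero)))

tally : Colour → Colour → Colour → Colour → ℕ
tally c₁ c₂ c₃ κ = indicator (isColour c₁ κ) + (indicator (isColour c₂ κ) + indicator (isColour c₃ κ))

-- Three colours with neither exactly one blue nor exactly one red all agree:
-- the only other splits are 3–0 and 0–3.
three-colours-agree : (c₁ c₂ c₃ : Colour) →
  ¬ tally c₁ c₂ c₃ blue ≡ 1 → ¬ tally c₁ c₂ c₃ red ≡ 1 → c₁ ≡ c₂ × c₂ ≡ c₃
three-colours-agree blue blue blue _      _     = refl , refl
three-colours-agree blue blue red  _      ¬red₁ = ⊥-elim (¬red₁ refl)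
three-colours-agree blue red  blue _      ¬red₁ = ⊥-elim (¬red₁ refl)
three-colours-agree blue red  red  ¬blue₁ _     = ⊥-elim (¬blue₁ refl)
three-colours-agree red  blue blue _      ¬red₁ = ⊥-elim (¬red₁ refl)
three-colours-agree red  blue red  ¬blue₁ _     = ⊥-elim (¬blue₁ refl)
three-colours-agree red  red  blue ¬blue₁ _     = ⊥-elim (¬blue₁ refl)
three-colours-agree red  red  red  _      _     = refl , refl

Star-invariant : {I J : Set} {T : Rel I 0ℓ} (f : I → J) →
  (∀ x y → T x y → f x ≡ f y) → Star T ⇒ (_≡_ on f)
Star-invariant f preserves = gfold f _≡_ (λ t eq → trans (preserves _ _ t) eq) refl

module _ {n : ℕ} (G : Graph n) where

  adjacent⇒distinct : ∀ {u v} → adj G u v ≡ true → ¬ u ≡ v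
  adjacent⇒distinct {u} uv refl = irefl G u uv

  module _ {x y z : Fin n}
    (xy : adj G x y ≡ true) (yz : adj G y z ≡ true) (xz : adj G x z ≡ true) where

    corner : Fin 3 → Fin n
    corner zero             = x
    corner (suc zero)       = y
    corner (suc (suc zero)) = z

    corner-injective : ∀ {i j} → corner i ≡ corner j → i ≡ j
    corner-injective {zero}             {zero}             _ = refl
    corner-injective {zero}             {suc zero}         e = ⊥-elim (adjacent⇒distinct xy e)
    corner-injective {zero}             {suc (suc zero)}   e = ⊥-elim (adjacent⇒distinct xz e)
    corner-injective {suc zero}         {zero}             e = ⊥-elim (adjacent⇒distinct xy (≡-sym e))
    corner-injective {suc zero}         {suc zero}         _ = refl
    corner-injective {suc zero}         {suc (suc zero)}   e = ⊥-elim (adjacent⇒distinct yz e)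
    corner-injective {suc (suc zero)}   {zero}             e = ⊥-elim (adjacent⇒distinct xz (≡-sym e))
    corner-injective {suc (suc zero)}   {suc zero}         e = ⊥-elim (adjacent⇒distinct yz (≡-sym e))
    corner-injective {suc (suc zero)}   {suc (suc zero)}   _ = refl

    corner-consecutive : ∀ i → adj G (corner i) (corner (next i)) ≡ true
    corner-consecutive zero             = xy
    corner-consecutive (suc zero)       = yz
    corner-consecutive (suc (suc zero)) = sym G x z xz

    triangle : Cycle G
    triangle = record
      { len = 0 ; vtx = corner ; inj = corner-injective ; consec = corner-consecutive }

  TriStep : (H : Subgraph G) → Rel (EdgeOf H) 0ℓ
  TriStep H e e′ = TriRel H e e′ ⊎ SameEdge {H = H} e e′

  edgeColour : Colouring G → (H : Subgraph G) → EdgeOf H → Colour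
  edgeColour δ H ((u , v) , _) = col δ u v

  module _ (δ : Colouring G)
    (no-almost-red  : (C : Cycle G) → ¬ AlmostRed δ C)
    (no-almost-blue : (C : Cycle G) → ¬ AlmostBlue δ C) where

    triangle-colour : ∀ {x y z a b}
      (xy : adj G x y ≡ true) (yz : adj G y z ≡ true) (xz : adj G x z ≡ true) →
      a ∈₃ (x , y , z) → b ∈₃ (x , y , z) → adj G a b ≡ true →
      col δ a b ≡ col δ x y
    triangle-colour {x} {y} {z} xy yz xz = edge-colour
      where
      C : Cycle G
      C = triangle xy yz xz

      edgeHas : Colour → Fin 3 → Bool
      edgeHas κ i = isColour (col δ (vtx C i) (vtx C (next i))) κ

      cycle-colours : col δ x y ≡ col δ y z × col δ y z ≡ col δ z x
      cycle-colours = three-colours-agree (col δ x y) (col δ y z) (col δ z x)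
        (λ blue₁ → no-almost-red  C (trans (count-three (edgeHas blue)) blue₁))
        (λ red₁  → no-almost-blue C (trans (count-three (edgeHas red)) red₁))

      yz≡xy : col δ y z ≡ col δ x y
      yz≡xy = ≡-sym (proj₁ cycle-colours)

      xz≡xy : col δ x z ≡ col δ x y
      xz≡xy = trans (col-sym δ x z xz) (≡-sym (trans (proj₁ cycle-colours) (proj₂ cycle-colours)))

      edge-colour : ∀ {a b} → a ∈₃ (x , y , z) → b ∈₃ (x , y , z) → adj G a b ≡ true →
        col δ a b ≡ col δ x y
      edge-colour (inj₁ refl)        (inj₁ refl)        ab = ⊥-elim (irefl G _ ab)
      edge-colour (inj₁ refl)        (inj₂ (inj₁ refl)) _  = refl
      edge-colour (inj₁ refl)        (inj₂ (inj₂ refl)) _  = xz≡xy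
      edge-colour (inj₂ (inj₁ refl)) (inj₁ refl)        _  = ≡-sym (col-sym δ x y xy)
      edge-colour (inj₂ (inj₁ refl)) (inj₂ (inj₁ refl)) ab = ⊥-elim (irefl G _ ab)
      edge-colour (inj₂ (inj₁ refl)) (inj₂ (inj₂ refl)) _  = yz≡xy
      edge-colour (inj₂ (inj₂ refl)) (inj₁ refl)        ab = trans (col-sym δ z x ab) xz≡xy
      edge-colour (inj₂ (inj₂ refl)) (inj₂ (inj₁ refl)) ab = trans (col-sym δ z y ab) yz≡xy
      edge-colour (inj₂ (inj₂ refl)) (inj₂ (inj₂ refl)) ab = ⊥-elim (irefl G _ ab)

    step-preserves-colour : (H : Subgraph G) (e e′ : EdgeOf H) →
      TriStep H e e′ → edgeColour δ H e ≡ edgeColour δ H e′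
    step-preserves-colour H ((a , b) , abᴴ) ((c , d) , cdᴴ)
      (inj₁ ((x , y , z) , (xyᴴ , yzᴴ , xzᴴ) , (a∈ , b∈) , (c∈ , d∈))) =
      trans (triangle-colour xy yz xz a∈ b∈ (hsub H a b abᴴ))
            (≡-sym (triangle-colour xy yz xz c∈ d∈ (hsub H c d cdᴴ)))
      where
      xy : adj G x y ≡ true
      xy = hsub H x y xyᴴ
      yz : adj G y z ≡ true
      yz = hsub H y z yzᴴ
      xz : adj G x z ≡ true
      xz = hsub H x z xzᴴ
    step-preserves-colour H _ _ (inj₂ (inj₁ (refl , refl))) = refl
    step-preserves-colour H ((a , b) , abᴴ) _ (inj₂ (inj₂ (refl , refl))) = col-sym δ a b (hsub H a b abᴴ)

lemma2 : {n : ℕ} (G : Graph n) (δ : Colouring G) →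
    ((C : Cycle G) → ¬ AlmostRed δ C) →
    ((C : Cycle G) → ¬ AlmostBlue δ C) →
    (H : Subgraph G) → TriConnected H →
    (e e′ : EdgeOf H) →
    col δ (proj₁ (proj₁ e)) (proj₂ (proj₁ e)) ≡ col δ (proj₁ (proj₁ e′)) (proj₂ (proj₁ e′))
lemma2 G δ no-almost-red no-almost-blue H connected e e′ =
  Star-invariant (edgeColour G δ H)
    (step-preserves-colour G δ no-almost-red no-almost-blue H)
    (connected e e′)
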